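{- Let $G=(V,E)$ be a finite strongly connected directed graph (loops and multiple arcs allowed), let $s\in V$ and let $T\subseteq V$ be nonempty such that every arc leaving a vertex of $T$ ends at $s$. Fix at every vertex $v$ a rotor mechanism $e_v^1,\dots,e_v^{d(v)}$ with heads $v^1,\dots,v^{d(v)}$, and suppose every rotor mechanism is palindromic: $v^i=v^{d(v)+1-i}$ for all $v\in V$ and $1\le i\le d(v)$. Then the hitting sequence $(t_n)_{n\ge1}$ is palindromic: for every $D\ge1$ with $t_{n+D}=t_n$ for all $n\ge1$, one has $t_i=t_{D+1-i}$ for all $1\le i\le D$.
   Context: $d(v)$ is the out-degree of $v$. A rotor mechanism at $v$ is an ordering $e_v^1,\dots,e_v^{d(v)}$ of the arcs leaving $v$, extended to all $i\in\mathbb{Z}$ periodically with period $d(v)$; $v^i$ is the head of $e_v^i$. The rotor walk from $s$ is the infinite sequence $x_0=s,x_1,\dots$ in which, for every vertex $v$ and $i\ge1$, the $i$-th occurrence of $v$ is immediately followed by $v^i$; the hitting sequence is the subsequence of terms of the rotor walk lying in $T$. -}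

module Defs where

open import Data.Nat using (ℕ; zero; suc; _+_; _*_; _<_)
open import Data.Fin using (Fin; toℕ; opposite; _≟_)
open import Data.Fin.Subset using (Subset; _∈_)
open import Data.Bool using (if_then_else_)
open import Relation.Nullary using (does)
open import Relation.Binary.PropositionalEquality using (_≡_)
open import Data.Product using (Σ; ∃; _×_)

-- A finite directed multigraph on the vertex set Fin n together with a rotor
-- mechanism at every vertex is encoded by
--   d  : Fin n → ℕ                        -- d v = out-degree of v
--   hd : (v : Fin n) → Fin (d v) → Fin n  -- hd v i = head of arc e_v^(i+1)
-- (0-based rotor index: hd v i is the paper's v^(i+1)).

module _ {n : ℕ} (d : Fin n → ℕ) (hd : (v : Fin n) → Fin (d v) → Fin n) where

  data Reach : Fin n → Fin n → Set where
    here : ∀ {v} → Reach v v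
    step : ∀ {v w} (i : Fin (d v)) → Reach (hd v i) w → Reach v w

  StronglyConnected : Set
  StronglyConnected = ∀ v w → Reach v w

  -- v^i = v^(d(v)+1-i) for 1 ≤ i ≤ d(v); 0-based: hd v i ≡ hd v (d v - 1 - i)
  PalindromicRotors : Set
  PalindromicRotors = ∀ v (i : Fin (d v)) → hd v i ≡ hd v (opposite i)

  occ : (ℕ → Fin n) → Fin n → ℕ → ℕ
  occ x v zero    = if does (x zero ≟ v) then 1 else 0
  occ x v (suc k) = occ x v k + (if does (x (suc k) ≟ v) then 1 else 0)

  -- x is the rotor walk from s: x 0 = s, and if x k = v is the i-th occurrence
  -- of v (i = occ x v k ≥ 1) then x (k+1) = v^i, where the rotor index is
  -- periodic with period d(v): v^i = hd v j with i = (j+1) + q·d(v), j < d(v).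
  IsRotorWalk : Fin n → (ℕ → Fin n) → Set
  IsRotorWalk s x =
    (x zero ≡ s) ×
    (∀ k → Σ (Fin (d (x k))) λ j → Σ ℕ λ q →
       (occ x (x k) k ≡ suc (toℕ j + q * d (x k))) × (x (suc k) ≡ hd (x k) j))

-- t is the hitting sequence of x in T (0-based: t i is the paper's t_(i+1)):
-- σ enumerates, in increasing order, exactly the times k with x k ∈ T.
IsHittingSequence : {n : ℕ} → Subset n → (ℕ → Fin n) → (ℕ → Fin n) → Set
IsHittingSequence T x t =
  Σ (ℕ → ℕ) λ σ →
    (∀ i → σ i < σ (suc i)) ×
    (∀ i → x (σ i) ∈ T) ×
    (∀ i → t i ≡ x (σ i)) ×
    (∀ k → x k ∈ T → ∃ λ i → σ i ≡ k)

-- Regard the rotor walk as chip-firing with the vertices of T as sinks: since every arc out of T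
-- returns to s, the walk up to its K-th hit of T is the rotor-router stabilisation of K chips
-- started at s, and the hits record which sink received each chip.  How many chips each sink
-- receives depends only on the initial rotors and the number of chips (abelian property).
-- By pigeonhole, two hit times L < L + P, both multiples of the period D, carry congruent rotor
-- configurations.  A palindromic rotor read forwards from the mirror of a configuration undoes a
-- stabilisation; comparing two stabilisations of L + y chips from the mirror of the rotors at L
-- shows that the hits among the first y and among the last P - y of P consecutive terms add up to
-- all hits among the P terms.  Comparing y = i and y = i + 1 gives t_i = t_(P-1-i), and
-- periodicity reduces P to D.
module Submission where

open import Defs
open import Data.Nat
  using (ℕ; zero; suc; _+_; _*_; _^_; _∸_; _≤_; _<_; z≤n; s≤s; s≤s⁻¹; NonZero; pred; _%_; _/_; _⊓_; _<?_)
open import Data.Nat.Properties hiding (_≟_)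
open import Data.Nat.DivMod
open import Data.Nat.Tactic.RingSolver using (solve-∀)
open import Data.Fin using (Fin; zero; suc; _≟_; opposite; toℕ; fromℕ<; funToFin; finToFun)
import Data.Fin.Properties as Finₚ
open Finₚ using (fromℕ<-cong; toℕ-fromℕ<; opposite-prop; toℕ-injective; fromℕ<-toℕ; toℕ<n;
                pigeonhole; nonZeroIndex; finToFun-funToFin)
open import Data.Fin.Subset using (Subset; _∈_; _∉_; Nonempty)
open import Data.Fin.Subset.Properties using (_∈?_)
open import Data.Bool using (if_then_else_)
open import Data.Product using (∃; ∃₂; _×_; _,_; proj₁; proj₂)
open import Data.Empty using (⊥-elim)
open import Function using (_∘_)
open import Relation.Nullary using (does; yes; no)
open import Relation.Binary.PropositionalEquality
open import Algebra.Properties.Semiring.Sum +-*-semiring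
  using (sum; sum-cong-≗; ∑-distrib-+; ∑-comm; *-distribˡ-sum; sum-replicate-zero)
open import Algebra.Properties.CommutativeSemigroup +-commutativeSemigroup
  using () renaming (interchange to +-interchange)

sum-zero : ∀ {m} {f : Fin m → ℕ} → (∀ i → f i ≡ 0) → sum f ≡ 0
sum-zero {m} f≡0 = trans (sum-cong-≗ f≡0) (sum-replicate-zero m)

sum-mono-≤ : ∀ {m} {f g : Fin m → ℕ} → (∀ i → f i ≤ g i) → sum f ≤ sum g
sum-mono-≤ {zero}  f≤g = z≤n
sum-mono-≤ {suc m} f≤g = +-mono-≤ (f≤g zero) (sum-mono-≤ (f≤g ∘ suc))

sum-single : ∀ {m} (f : Fin m → ℕ) (u : Fin m) → (∀ w → w ≢ u → f w ≡ 0) → sum f ≡ f u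
sum-single f zero    f≡0 = trans (cong (f zero +_) (sum-zero (λ i → f≡0 (suc i) λ ()))) (+-identityʳ _)
sum-single f (suc u) f≡0 = cong₂ _+_ (f≡0 zero λ ())
  (sum-single (f ∘ suc) u (λ w w≢u → f≡0 (suc w) (w≢u ∘ Finₚ.suc-injective)))

sum-mono-≤-tight : ∀ {m} {f g : Fin m → ℕ} → (∀ i → f i ≤ g i) → sum g ≤ sum f → ∀ i → f i ≡ g i
sum-mono-≤-tight {suc m} {f} {g} f≤g Σg≤Σf zero = ≤-antisym (f≤g zero)
  (+-cancelʳ-≤ (sum (f ∘ suc)) (g zero) (f zero)
    (≤-trans (+-monoʳ-≤ (g zero) (sum-mono-≤ (f≤g ∘ suc))) Σg≤Σf))
sum-mono-≤-tight {suc m} {f} {g} f≤g Σg≤Σf (suc i) = sum-mono-≤-tight (f≤g ∘ suc)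
  (+-cancelˡ-≤ (g zero) _ _ (≤-trans Σg≤Σf (+-monoˡ-≤ _ (f≤g zero)))) i

≤-sum : ∀ {m} (f : Fin m → ℕ) i → f i ≤ sum f
≤-sum f zero    = m≤m+n (f zero) _
≤-sum f (suc i) = ≤-trans (≤-sum (f ∘ suc) i) (m≤n+m _ (f zero))

δ : ∀ {n} → Fin n → Fin n → ℕ
δ a b = if does (a ≟ b) then 1 else 0

δ-refl : ∀ {n} (a : Fin n) → δ a a ≡ 1
δ-refl a with a ≟ a
... | yes _   = refl
... | no  a≢a = ⊥-elim (a≢a refl)

δ-≢ : ∀ {n} {a b : Fin n} → a ≢ b → δ a b ≡ 0
δ-≢ {a = a} {b} a≢b with a ≟ b
... | yes a≡b = ⊥-elim (a≢b a≡b)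
... | no  _   = refl

δ≡1⇒≡ : ∀ {n} {a b : Fin n} → δ a b ≡ 1 → a ≡ b
δ≡1⇒≡ {a = a} {b} δ≡1 with a ≟ b
... | yes a≡b = a≡b
... | no  _   = ⊥-elim (0≢1+n δ≡1)

sum-δ : ∀ {n} (a : Fin n) → sum (δ a) ≡ 1
sum-δ a = trans (sum-single (δ a) a (λ w w≢a → δ-≢ (w≢a ∘ sym))) (δ-refl a)

sum-δ-weighted : ∀ {n} (f : Fin n → ℕ) (a : Fin n) → sum (λ w → f w * δ a w) ≡ f a
sum-δ-weighted f a = trans
  (sum-single _ a (λ w w≢a → trans (cong (f w *_) (δ-≢ (w≢a ∘ sym))) (*-zeroʳ (f w))))
  (trans (cong (f a *_) (δ-refl a)) (*-identityʳ (f a)))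

module _ {n : ℕ} where

  tally : (ℕ → Fin n) → (Fin n → ℕ) → ℕ → ℕ
  tally f g zero    = 0
  tally f g (suc y) = tally f g y + g (f y)

  count : (ℕ → Fin n) → Fin n → ℕ → ℕ
  count f u = tally f (λ a → δ a u)

  tally-mono-≤ : ∀ f g {a b} → a ≤ b → tally f g a ≤ tally f g b
  tally-mono-≤ f g {a} {b} a≤b with m≤n⇒∃[o]m+o≡n a≤b
  ... | k , refl = go k
    where
    go : ∀ k → tally f g a ≤ tally f g (a + k)
    go zero    = ≤-reflexive (cong (tally f g) (sym (+-identityʳ a)))
    go (suc k) = ≤-trans (≤-trans (go k) (m≤m+n _ _))
                         (≤-reflexive (cong (tally f g) (sym (+-suc a k))))

  tally-shift : ∀ f g L → (∀ i → f (L + i) ≡ f i) →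
                ∀ y → tally f g (L + y) ≡ tally f g L + tally f g y
  tally-shift f g L shift zero    = trans (cong (tally f g) (+-identityʳ L)) (sym (+-identityʳ _))
  tally-shift f g L shift (suc y) = begin
    tally f g (L + suc y)                        ≡⟨ cong (tally f g) (+-suc L y) ⟩
    tally f g (L + y) + g (f (L + y))            ≡⟨ cong₂ _+_ (tally-shift f g L shift y) (cong g (shift y)) ⟩
    tally f g L + tally f g y + g (f y)          ≡⟨ +-assoc (tally f g L) _ _ ⟩
    tally f g L + tally f g (suc y)              ∎
    where open ≡-Reasoning

  count-palindrome : ∀ f {P i} → i < P →
    (∀ y → y ≤ P → count f (f i) y + count f (f i) (P ∸ y) ≡ count f (f i) P) →
    f i ≡ f (P ∸ suc i)
  count-palindrome f {P} {i} i<P split = sym (δ≡1⇒≡ (trans δj≡δi (δ-refl (f i))))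
    where
    u : Fin n
    u = f i
    j : ℕ
    j = P ∸ suc i
    P∸i≡1+j : P ∸ i ≡ suc j
    P∸i≡1+j = +-∸-assoc 1 i<P
    δj≡δi : δ (f j) u ≡ δ (f i) u
    δj≡δi = +-cancelˡ-≡ (count f u i + count f u j) _ _ (begin
      count f u i + count f u j + δ (f j) u   ≡⟨ +-assoc (count f u i) _ _ ⟩
      count f u i + count f u (suc j)         ≡⟨ cong (λ z → count f u i + count f u z) P∸i≡1+j ⟨
      count f u i + count f u (P ∸ i)         ≡⟨ split i (<⇒≤ i<P) ⟩
      count f u P                             ≡⟨ split (suc i) i<P ⟨
      count f u (suc i) + count f u j         ≡⟨ +-assoc (count f u i) _ _ ⟩
      count f u i + (δ (f i) u + count f u j) ≡⟨ cong (count f u i +_) (+-comm _ (count f u j)) ⟩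
      count f u i + (count f u j + δ (f i) u) ≡⟨ +-assoc (count f u i) _ _ ⟨
      count f u i + count f u j + δ (f i) u   ∎)
      where open ≡-Reasoning

  sum-*-count : ∀ (f : ℕ → Fin n) g τ → sum (λ w → g w * count f w τ) ≡ tally f g τ
  sum-*-count f g zero    = sum-zero (λ w → *-zeroʳ (g w))
  sum-*-count f g (suc τ) = begin
    sum (λ w → g w * (count f w τ + δ (f τ) w))
      ≡⟨ sum-cong-≗ (λ w → *-distribˡ-+ (g w) _ _) ⟩
    sum (λ w → g w * count f w τ + g w * δ (f τ) w)
      ≡⟨ ∑-distrib-+ (λ w → g w * count f w τ) _ ⟩
    sum (λ w → g w * count f w τ) + sum (λ w → g w * δ (f τ) w)
      ≡⟨ cong₂ _+_ (sum-*-count f g τ) (sum-δ-weighted g (f τ)) ⟩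
    tally f g τ + g (f τ)
      ∎
    where open ≡-Reasoning

  periodic-multiple : ∀ (f : ℕ → Fin n) D → (∀ m → f (m + D) ≡ f m) → ∀ j m → f (j * D + m) ≡ f m
  periodic-multiple f D per zero    m = refl
  periodic-multiple f D per (suc j) m = begin
    f (D + j * D + m)  ≡⟨ cong f (trans (+-assoc D (j * D) m) (+-comm D _)) ⟩
    f (j * D + m + D)  ≡⟨ per (j * D + m) ⟩
    f (j * D + m)      ≡⟨ periodic-multiple f D per j m ⟩
    f m                ∎
    where open ≡-Reasoning

0<n<2m∧n%m≡0⇒n≡m : ∀ {m n} .{{_ : NonZero m}} → 0 < n → n < m + m → n % m ≡ 0 → n ≡ m
0<n<2m∧n%m≡0⇒n≡m {m} {n} 0<n n<2m n%m≡0 with n <? m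
... | yes n<m = ⊥-elim (<⇒≢ 0<n (sym (trans (sym (m<n⇒m%n≡m n<m)) n%m≡0)))
... | no  n≮m = trans (sym (m∸n+n≡m m≤n)) (cong (_+ m) n∸m≡0)
  where
  m≤n : m ≤ n
  m≤n = ≮⇒≥ n≮m
  n∸m≡0 : n ∸ m ≡ 0
  n∸m≡0 = trans (sym (m<n⇒m%n≡m (m<n+o⇒m∸n<o n m n<2m))) (trans (m≤n⇒[n∸m]%m≡n%m m≤n) n%m≡0)

residues-complementary : ∀ m .{{_ : NonZero m}} a b → (a + suc b) % m ≡ 0 → a % m + suc (b % m) ≡ m
residues-complementary m a b ≡0 = 0<n<2m∧n%m≡0⇒n≡m
  (<-≤-trans (s≤s z≤n) (m≤n+m (suc (b % m)) (a % m)))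
  (+-mono-<-≤ (m%n<n a m) (m%n<n b m))
  (trans (sym ([m+kn]%n≡m%n _ (a / m + b / m) m)) (trans (cong (_% m) (sym a+1+b≡)) ≡0))
  where
  a+1+b≡ : a + suc b ≡ a % m + suc (b % m) + (a / m + b / m) * m
  a+1+b≡ = trans (cong₂ (λ x y → x + suc y) (m≡m%n+[m/n]*n a m) (m≡m%n+[m/n]*n b m))
    (rearrange (a % m) (a / m) (b % m) (b / m) m)
    where
    rearrange : ∀ p q r s m → p + q * m + suc (r + s * m) ≡ p + suc r + (q + s) * m
    rearrange = solve-∀

module Residues {n : ℕ} (d : Fin n → ℕ) (d≢0 : ∀ v → NonZero (d v)) where

  instance
    d-nonZero : ∀ {v} → NonZero (d v)
    d-nonZero {v} = d≢0 v

  residues : (ℕ → Fin n → ℕ) → ℕ → Fin n → Fin (sum d)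
  residues f j v = fromℕ< (<-≤-trans (m%n<n (f j v) (d v)) (≤-sum d v))

  pigeonhole-% : (f : ℕ → Fin n → ℕ) → ∃₂ λ a b → a < b × ∀ v → f a v % d v ≡ f b v % d v
  pigeonhole-% f with pigeonhole (n<1+n (sum d ^ n)) (λ k → funToFin (residues f (toℕ k)))
  ... | a , b , a<b , code≡ = toℕ a , toℕ b , a<b , λ v →
    trans (sym (toℕ-fromℕ< _)) (trans (cong toℕ (residues≡ v)) (toℕ-fromℕ< _))
    where
    residues≡ : ∀ v → residues f (toℕ a) v ≡ residues f (toℕ b) v
    residues≡ v = trans (sym (finToFun-funToFin (residues f (toℕ a)) v))
      (trans (cong (λ c → finToFun c v) code≡) (finToFun-funToFin (residues f (toℕ b)) v))

module Rotors {n : ℕ} (d : Fin n → ℕ) (hd : (v : Fin n) → Fin (d v) → Fin n)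
  (d≢0 : ∀ v → NonZero (d v)) where

  open Residues d d≢0 public

  rotor : Fin n → ℕ → Fin n
  rotor v i = hd v (fromℕ< (m%n<n i (d v)))

  rotor-% : ∀ v {a b} → a % d v ≡ b % d v → rotor v a ≡ rotor v b
  rotor-% v {a} {b} a≡b = cong (hd v) (fromℕ<-cong _ _ a≡b (m%n<n a (d v)) (m%n<n b (d v)))

  rotor-toℕ : ∀ v (j : Fin (d v)) → rotor v (toℕ j) ≡ hd v j
  rotor-toℕ v j = cong (hd v)
    (trans (fromℕ<-cong _ _ (m<n⇒m%n≡m (toℕ<n j)) _ (toℕ<n j)) (fromℕ<-toℕ j (toℕ<n j)))

  sends : Fin n → Fin n → ℕ → ℕ → ℕ
  sends v w a zero    = 0
  sends v w a (suc y) = δ (rotor v a) w + sends v w (suc a) y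

  sends-+ : ∀ v w a x y → sends v w a (x + y) ≡ sends v w a x + sends v w (a + x) y
  sends-+ v w a zero    y = cong (λ b → sends v w b y) (sym (+-identityʳ a))
  sends-+ v w a (suc x) y = trans
    (cong (δ (rotor v a) w +_) (trans (sends-+ v w (suc a) x y)
      (cong (λ b → sends v w (suc a) x + sends v w b y) (sym (+-suc a x)))))
    (sym (+-assoc (δ (rotor v a) w) _ _))

  sends-mono-≤ : ∀ v w a {x y} → x ≤ y → sends v w a x ≤ sends v w a y
  sends-mono-≤ v w a {x} {y} x≤y = subst (λ z → sends v w a x ≤ sends v w a z) (m+[n∸m]≡n x≤y)
    (subst (sends v w a x ≤_) (sym (sends-+ v w a x (y ∸ x))) (m≤m+n _ _))

  sum-sends : ∀ v a y → sum (λ w → sends v w a y) ≡ y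
  sum-sends v a zero    = sum-replicate-zero n
  sum-sends v a (suc y) = trans (∑-distrib-+ (δ (rotor v a)) (λ w → sends v w (suc a) y))
    (cong₂ _+_ (sum-δ (rotor v a)) (sum-sends v (suc a) y))

  sends-% : ∀ v w y {a b} → a % d v ≡ b % d v → sends v w a y ≡ sends v w b y
  sends-% v w zero    a≡b = refl
  sends-% v w (suc y) {a} {b} a≡b =
    cong₂ _+_ (cong (λ z → δ z w) (rotor-% v a≡b)) (sends-% v w y 1+a≡1+b)
    where
    1+a≡1+b : suc a % d v ≡ suc b % d v
    1+a≡1+b = trans (%-distribˡ-+ 1 a (d v))
      (trans (cong (λ z → (1 % d v + z) % d v) a≡b) (sym (%-distribˡ-+ 1 b (d v))))

  initial : Fin n → ℕ
  initial _ = 0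

  -- mirror v M ≡ -M (mod d v): for a palindromic rotor, reading forwards from mirror v M
  -- replays positions M - 1, M - 2, …, 0.
  mirror : Fin n → ℕ → ℕ
  mirror v M = pred (d v) * M

  +-mirror-% : ∀ v M → (M + mirror v M) % d v ≡ 0
  +-mirror-% v M = trans (cong (_% d v) M+mirror≡) (m*n%n≡0 M (d v))
    where
    M+mirror≡ : M + mirror v M ≡ M * d v
    M+mirror≡ = trans (cong (_* M) (suc-pred (d v))) (*-comm (d v) M)

  initial≡mirror+ : ∀ v M → initial v % d v ≡ (mirror v M + M) % d v
  initial≡mirror+ v M = trans (m*n%n≡0 0 (d v))
    (sym (trans (cong (_% d v) (+-comm (mirror v M) M)) (+-mirror-% v M)))

  mirror-% : ∀ v {M M′} → M % d v ≡ M′ % d v → mirror v M % d v ≡ mirror v M′ % d v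
  mirror-% v {M} {M′} M≡M′ = trans (%-distribˡ-* (pred (d v)) M (d v))
    (trans (cong (λ z → (pred (d v) % d v * z) % d v) M≡M′)
           (sym (%-distribˡ-* (pred (d v)) M′ (d v))))

  module _ (pal : PalindromicRotors d hd) where

    rotor-palindromic : ∀ v {a b} → (a + suc b) % d v ≡ 0 → rotor v a ≡ rotor v b
    rotor-palindromic v {a} {b} ≡0 = begin
      rotor v a          ≡⟨⟩
      hd v i             ≡⟨ pal v i ⟩
      hd v (opposite i)  ≡⟨ cong (hd v) (toℕ-injective opposite-i≡j) ⟩
      hd v j             ≡⟨⟩
      rotor v b          ∎
      where
      open ≡-Reasoning
      i j : Fin (d v)
      i = fromℕ< (m%n<n a (d v))
      j = fromℕ< (m%n<n b (d v))
      opposite-i≡j : toℕ (opposite i) ≡ toℕ j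
      opposite-i≡j = begin
        toℕ (opposite i)                         ≡⟨ opposite-prop i ⟩
        d v ∸ suc (toℕ i)                        ≡⟨ cong (λ z → d v ∸ suc z) (toℕ-fromℕ< _) ⟩
        d v ∸ suc (a % d v)                      ≡⟨ cong (_∸ suc (a % d v)) complementary ⟨
        a % d v + suc (b % d v) ∸ suc (a % d v)  ≡⟨ cong (_∸ suc (a % d v)) (+-suc (a % d v) _) ⟩
        suc (a % d v) + b % d v ∸ suc (a % d v)  ≡⟨ m+n∸m≡n (suc (a % d v)) _ ⟩
        b % d v                                  ≡⟨ toℕ-fromℕ< _ ⟨
        toℕ j                                    ∎
        where
        complementary : a % d v + suc (b % d v) ≡ d v
        complementary = residues-complementary (d v) a b ≡0

    sends-palindromic : ∀ v w {a} y {b} → (a + (y + b)) % d v ≡ 0 → sends v w a y ≡ sends v w b y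
    sends-palindromic v w     zero    ≡0 = refl
    sends-palindromic v w {a} (suc y) {b} ≡0 = begin
      δ (rotor v a) w + sends v w (suc a) y     ≡⟨ cong₂ _+_ (cong (λ z → δ z w) rotor-a≡) IH ⟩
      δ (rotor v (b + y)) w + sends v w b y     ≡⟨ +-comm _ (sends v w b y) ⟩
      sends v w b y + δ (rotor v (b + y)) w     ≡⟨ cong (sends v w b y +_) (+-identityʳ _) ⟨
      sends v w b y + sends v w (b + y) 1       ≡⟨ sends-+ v w b y 1 ⟨
      sends v w b (y + 1)                       ≡⟨ cong (sends v w b) (+-comm y 1) ⟩
      sends v w b (suc y)                       ∎
      where
      open ≡-Reasoning
      rotor-a≡ : rotor v a ≡ rotor v (b + y)
      rotor-a≡ = trans (rotor-palindromic v ≡0) (cong (rotor v) (+-comm y b))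
      IH : sends v w (suc a) y ≡ sends v w b y
      IH = sends-palindromic v w y (trans (cong (_% d v) (sym (+-suc a (y + b)))) ≡0)

    sends-mirror : ∀ v w {N M} → N ≤ M →
                   sends v w 0 N + sends v w (mirror v M) (M ∸ N) ≡ sends v w 0 M
    sends-mirror v w {N} {M} N≤M = begin
      sends v w 0 N + sends v w (mirror v M) (M ∸ N)  ≡⟨ cong (sends v w 0 N +_) reversed ⟨
      sends v w 0 N + sends v w N (M ∸ N)             ≡⟨ sends-+ v w 0 N (M ∸ N) ⟨
      sends v w 0 (N + (M ∸ N))                       ≡⟨ cong (sends v w 0) (m+[n∸m]≡n N≤M) ⟩
      sends v w 0 M                                   ∎
      where
      open ≡-Reasoning
      reversed : sends v w N (M ∸ N) ≡ sends v w (mirror v M) (M ∸ N)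
      reversed = sends-palindromic v w (M ∸ N) (trans (cong (_% d v) N+[[M∸N]+mirror]≡) (+-mirror-% v M))
        where
        N+[[M∸N]+mirror]≡ : N + ((M ∸ N) + mirror v M) ≡ M + mirror v M
        N+[[M∸N]+mirror]≡ = trans (sym (+-assoc N (M ∸ N) _)) (cong (_+ mirror v M) (m+[n∸m]≡n N≤M))

  module ChipFiring (T : Subset n) (s : Fin n) (s∉T : s ∉ T) where

    χ χᶜ : Fin n → ℕ
    χ  v = if does (v ∈? T) then 1 else 0
    χᶜ v = if does (v ∈? T) then 0 else 1

    χ-∈ : ∀ {v} → v ∈ T → χ v ≡ 1
    χ-∈ {v} v∈T with v ∈? T
    ... | yes _   = refl
    ... | no  v∉T = ⊥-elim (v∉T v∈T)

    χ-∉ : ∀ {v} → v ∉ T → χ v ≡ 0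
    χ-∉ {v} v∉T with v ∈? T
    ... | yes v∈T = ⊥-elim (v∉T v∈T)
    ... | no  _   = refl

    χᶜ-∉ : ∀ {v} → v ∉ T → χᶜ v ≡ 1
    χᶜ-∉ {v} v∉T with v ∈? T
    ... | yes v∈T = ⊥-elim (v∉T v∈T)
    ... | no  _   = refl

    χᶜ*+χ* : ∀ v x → χᶜ v * x + χ v * x ≡ x
    χᶜ*+χ* v x with v ∈? T
    ... | yes _ = +-identityʳ x
    ... | no  _ = trans (+-identityʳ _) (+-identityʳ x)

    χᶜ*-mono-≤ : ∀ {f g : Fin n → ℕ} → (∀ v → v ∉ T → f v ≤ g v) → ∀ v → χᶜ v * f v ≤ χᶜ v * g v
    χᶜ*-mono-≤ f≤g v with v ∈? T
    ... | yes _   = z≤n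
    ... | no  v∉T = +-monoˡ-≤ 0 (f≤g v v∉T)

    sum-χᶜ+χ : ∀ (f : Fin n → ℕ) → sum (λ v → χᶜ v * f v) + sum (λ v → χ v * f v) ≡ sum f
    sum-χᶜ+χ f = trans (sym (∑-distrib-+ (λ v → χᶜ v * f v) (λ v → χ v * f v)))
                       (sum-cong-≗ (λ v → χᶜ*+χ* v (f v)))

    source : ℕ → Fin n → ℕ
    source k v = δ s v * k

    source-+ : ∀ k k′ v → source (k + k′) v ≡ source k v + source k′ v
    source-+ k k′ v = *-distribˡ-+ (δ s v) k k′

    sum-χᶜ*source : ∀ k → sum (λ v → χᶜ v * source k v) ≡ k
    sum-χᶜ*source k = trans (sum-single _ s off-s)
      (trans (cong₂ _*_ (χᶜ-∉ s∉T) (cong (_* k) (δ-refl s))) (trans (*-identityˡ _) (*-identityˡ k)))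
      where
      off-s : ∀ v → v ≢ s → χᶜ v * source k v ≡ 0
      off-s v v≢s = trans (cong (λ z → χᶜ v * (z * k)) (δ-≢ (v≢s ∘ sym))) (*-zeroʳ (χᶜ v))

    received : (e u : Fin n → ℕ) → Fin n → ℕ
    received e u v = sum (λ w → χᶜ w * sends w v (e w) (u w))

    -- k chips start at s and the vertices of T absorb chips; every other vertex w, with its
    -- rotor starting at position e w, fires u w times, once for each chip it receives.
    Odometer : (e : Fin n → ℕ) → ℕ → (u : Fin n → ℕ) → Set
    Odometer e k u = ∀ v → v ∉ T → u v ≡ source k v + received e u v

    sinkTotal : (e u : Fin n → ℕ) → ℕ
    sinkTotal e u = sum (λ v → χ v * received e u v)

    received-mono-≤ : ∀ e {u u′} → (∀ w → u w ≤ u′ w) → ∀ v → received e u v ≤ received e u′ v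
    received-mono-≤ e u≤u′ v = sum-mono-≤ (λ w → *-monoʳ-≤ (χᶜ w) (sends-mono-≤ w v (e w) (u≤u′ w)))

    sum-received : ∀ e u → sum (received e u) ≡ sum (λ w → χᶜ w * u w)
    sum-received e u = trans (sym (∑-comm (λ w v → χᶜ w * sends w v (e w) (u w))))
      (sum-cong-≗ (λ w → trans (sym (*-distribˡ-sum (χᶜ w) (λ v → sends w v (e w) (u w))))
                                (cong (χᶜ w *_) (sum-sends w (e w) (u w)))))

    conservation : ∀ e u →
      sum (λ v → χᶜ v * received e u v) + sinkTotal e u ≡ sum (λ w → χᶜ w * u w)
    conservation e u = trans (sum-χᶜ+χ (received e u)) (sum-received e u)

    sum-χᶜ*[source+] : ∀ k (f : Fin n → ℕ) →
      sum (λ v → χᶜ v * (source k v + f v)) ≡ k + sum (λ v → χᶜ v * f v)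
    sum-χᶜ*[source+] k f = trans (sum-cong-≗ (λ v → *-distribˡ-+ (χᶜ v) (source k v) (f v)))
      (trans (∑-distrib-+ (λ v → χᶜ v * source k v) (λ v → χᶜ v * f v))
        (cong (_+ sum (λ v → χᶜ v * f v)) (sum-χᶜ*source k)))

    sinkTotal-≤ : ∀ e k u → (∀ v → v ∉ T → u v ≤ source k v + received e u v) → sinkTotal e u ≤ k
    sinkTotal-≤ e k u u≤ = +-cancelˡ-≤ R _ _ (begin
      R + sinkTotal e u        ≡⟨ conservation e u ⟩
      sum (λ w → χᶜ w * u w)   ≤⟨ sum-mono-≤ (χᶜ*-mono-≤ {u} {λ v → source k v + received e u v} u≤) ⟩
      sum (λ v → χᶜ v * (source k v + received e u v))
                               ≡⟨ sum-χᶜ*[source+] k (received e u) ⟩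
      k + R                    ≡⟨ +-comm k R ⟩
      R + k                    ∎)
      where
      open ≤-Reasoning
      R : ℕ
      R = sum (λ v → χᶜ v * received e u v)

    ≤-sinkTotal : ∀ e k u → (∀ v → v ∉ T → source k v + received e u v ≤ u v) → k ≤ sinkTotal e u
    ≤-sinkTotal e k u ≤u = +-cancelˡ-≤ R _ _ (begin
      R + k                    ≡⟨ +-comm R k ⟩
      k + R                    ≡⟨ sum-χᶜ*[source+] k (received e u) ⟨
      sum (λ v → χᶜ v * (source k v + received e u v))
                               ≤⟨ sum-mono-≤ (χᶜ*-mono-≤ {λ v → source k v + received e u v} {u} ≤u) ⟩
      sum (λ w → χᶜ w * u w)   ≡⟨ conservation e u ⟨
      R + sinkTotal e u        ∎)
      where
      open ≤-Reasoning
      R : ℕ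
      R = sum (λ v → χᶜ v * received e u v)

    -- The minimum w of two odometers still satisfies source + received ≤ w, so its sink total
    -- is at least k, while that of each odometer is at most k.
    sink-received-unique : ∀ e k {u u′} → Odometer e k u → Odometer e k u′ →
                           ∀ t → t ∈ T → received e u t ≡ received e u′ t
    sink-received-unique e k {u} {u′} odo odo′ t t∈T =
      trans (sym (received-w≡ odo w≤u)) (received-w≡ odo′ w≤u′)
      where
      w : Fin n → ℕ
      w v = u v ⊓ u′ v
      w≤u : ∀ v → w v ≤ u v
      w≤u v = m⊓n≤m (u v) (u′ v)
      w≤u′ : ∀ v → w v ≤ u′ v
      w≤u′ v = m⊓n≤n (u v) (u′ v)
      below : ∀ {u₁} → Odometer e k u₁ → (∀ v → w v ≤ u₁ v) →
              ∀ v → v ∉ T → source k v + received e w v ≤ u₁ v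
      below odo₁ w≤u₁ v v∉T =
        ≤-trans (+-monoʳ-≤ (source k v) (received-mono-≤ e w≤u₁ v)) (≤-reflexive (sym (odo₁ v v∉T)))
      w-super : ∀ v → v ∉ T → source k v + received e w v ≤ w v
      w-super v v∉T = ⊓-glb (below odo w≤u v v∉T) (below odo′ w≤u′ v v∉T)
      received-w≡ : ∀ {u₁} → Odometer e k u₁ → (∀ v → w v ≤ u₁ v) → received e w t ≡ received e u₁ t
      received-w≡ {u₁} odo₁ w≤u₁ = trans (sym (*-identityˡ _))
        (trans (subst (λ c → c * received e w t ≡ c * received e u₁ t) (χ-∈ t∈T) tight) (*-identityˡ _))
        where
        tight : χ t * received e w t ≡ χ t * received e u₁ t
        tight = sum-mono-≤-tight (λ v → *-monoʳ-≤ (χ v) (received-mono-≤ e w≤u₁ v))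
          (≤-trans (sinkTotal-≤ e k u₁ (λ v v∉T → ≤-reflexive (odo₁ v v∉T))) (≤-sinkTotal e k w w-super)) t

    received-zero : ∀ e v → received e (λ _ → 0) v ≡ 0
    received-zero e v = sum-zero (λ w → *-zeroʳ (χᶜ w))

    Odometer-zero : ∀ e → Odometer e 0 (λ _ → 0)
    Odometer-zero e v _ = sym (cong₂ _+_ (*-zeroʳ (δ s v)) (received-zero e v))

    received-+ : ∀ e u u′ v →
      received e (λ w → u w + u′ w) v ≡ received e u v + received (λ w → e w + u w) u′ v
    received-+ e u u′ v = trans
      (sum-cong-≗ (λ w → trans (cong (χᶜ w *_) (sends-+ w v (e w) (u w) (u′ w)))
                               (*-distribˡ-+ (χᶜ w) _ _)))
      (∑-distrib-+ (λ w → χᶜ w * sends w v (e w) (u w)) (λ w → χᶜ w * sends w v (e w + u w) (u′ w)))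

    received-% : ∀ {e e′} → (∀ w → e w % d w ≡ e′ w % d w) →
                 ∀ u v → received e u v ≡ received e′ u v
    received-% e≡e′ u v = sum-cong-≗ (λ w → cong (χᶜ w *_) (sends-% w v (u w) (e≡e′ w)))

    Odometer-% : ∀ {e e′ k u} → (∀ w → e w % d w ≡ e′ w % d w) → Odometer e k u → Odometer e′ k u
    Odometer-% {k = k} {u} e≡e′ odo v v∉T =
      trans (odo v v∉T) (cong (source k v +_) (received-% e≡e′ u v))

    Odometer-+ : ∀ {e k k′ u u′} → Odometer e k u → Odometer (λ w → e w + u w) k′ u′ →
                 Odometer e (k + k′) (λ w → u w + u′ w)
    Odometer-+ {e} {k} {k′} {u} {u′} odo odo′ v v∉T = begin
      u v + u′ v
        ≡⟨ cong₂ _+_ (odo v v∉T) (odo′ v v∉T) ⟩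
      (source k v + received e u v) + (source k′ v + received e′ u′ v)
        ≡⟨ +-interchange (source k v) _ _ _ ⟩
      (source k v + source k′ v) + (received e u v + received e′ u′ v)
        ≡⟨ cong₂ _+_ (source-+ k k′ v) (received-+ e u u′ v) ⟨
      source (k + k′) v + received e (λ w → u w + u′ w) v
        ∎
      where
      open ≡-Reasoning
      e′ : Fin n → ℕ
      e′ w = e w + u w

    module _ (pal : PalindromicRotors d hd) where

      received-mirror : ∀ {N M} → (∀ w → N w ≤ M w) → ∀ v →
        received initial N v + received (λ w → mirror w (M w)) (λ w → M w ∸ N w) v ≡ received initial M v
      received-mirror {N} {M} N≤M v = trans
        (sym (∑-distrib-+ (λ w → χᶜ w * sends w v 0 (N w))
                          (λ w → χᶜ w * sends w v (mirror w (M w)) (M w ∸ N w))))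
        (sum-cong-≗ (λ w → trans (sym (*-distribˡ-+ (χᶜ w) _ _))
                                 (cong (χᶜ w *_) (sends-mirror pal w v (N≤M w)))))

      Odometer-mirror : ∀ {K k N M} → Odometer initial K N → Odometer initial (K + k) M →
                        (∀ w → N w ≤ M w) → Odometer (λ w → mirror w (M w)) k (λ w → M w ∸ N w)
      Odometer-mirror {K} {k} {N} {M} odoN odoM N≤M v v∉T = begin
        M v ∸ N v                                   ≡⟨ cong (_∸ N v) M≡N+ ⟩
        N v + (source k v + received e R v) ∸ N v   ≡⟨ m+n∸m≡n (N v) _ ⟩
        source k v + received e R v                 ∎
        where
        open ≡-Reasoning
        e R : Fin n → ℕ
        e w = mirror w (M w)
        R w = M w ∸ N w
        M≡N+ : M v ≡ N v + (source k v + received e R v)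
        M≡N+ = begin
          M v
            ≡⟨ odoM v v∉T ⟩
          source (K + k) v + received initial M v
            ≡⟨ cong₂ _+_ (source-+ K k v) (sym (received-mirror N≤M v)) ⟩
          (source K v + source k v) + (received initial N v + received e R v)
            ≡⟨ +-interchange (source K v) _ _ _ ⟩
          (source K v + received initial N v) + (source k v + received e R v)
            ≡⟨ cong (_+ (source k v + received e R v)) (odoN v v∉T) ⟨
          N v + (source k v + received e R v)
            ∎

      received-mirror-+ : ∀ M u v → received (λ w → mirror w (M w)) (λ w → M w + u w) v
                                    ≡ received initial M v + received initial u v
      received-mirror-+ M u v = trans (received-+ e M u v) (cong₂ _+_
        (trans (cong (_+ received e M v) (sym (received-zero initial v))) (received-mirror {M = M} (λ _ → z≤n) v))
        (sym (received-% (λ w → initial≡mirror+ w (M w)) u v)))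
        where
        e : Fin n → ℕ
        e w = mirror w (M w)

      Odometer-mirror-+ : ∀ {K k M U} → Odometer initial K M → Odometer initial k U →
                          Odometer (λ w → mirror w (M w)) (K + k) (λ w → M w + U w)
      Odometer-mirror-+ {M = M} odoM odoU =
        Odometer-+ (Odometer-mirror (Odometer-zero initial) odoM (λ _ → z≤n))
                   (Odometer-% (λ w → initial≡mirror+ w (M w)) odoU)

      -- With O K the odometer of K chips, both O L + O y and O (L + P) ∸ O (P ∸ y) stabilise
      -- L + y chips from the mirror of O L (congruent to that of O (L + P)), hence feed each
      -- sink equally.
      sink-received-split : (O : ℕ → Fin n → ℕ) → (∀ K → Odometer initial K (O K)) →
        (∀ {K K′} → K ≤ K′ → ∀ w → O K w ≤ O K′ w) →
        ∀ {L P} → (∀ w → O L w % d w ≡ O (L + P) w % d w) → ∀ {y} → y ≤ P → ∀ t → t ∈ T →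
        received initial (O L) t + received initial (O y) t + received initial (O (P ∸ y)) t
          ≡ received initial (O (L + P)) t
      sink-received-split O odometer mono {L} {P} OL≡OL+P {y} y≤P t t∈T = begin
        received initial (O L) t + received initial (O y) t + received initial (O z) t
          ≡⟨ cong (_+ received initial (O z) t) (received-mirror-+ (O L) (O y) t) ⟨
        received e (λ w → O L w + O y w) t + received initial (O z) t
          ≡⟨ cong (_+ received initial (O z) t) (sink-received-unique e (L + y)
               (Odometer-mirror-+ (odometer L) (odometer y)) odometer-R t t∈T) ⟩
        received e R t + received initial (O z) t
          ≡⟨ +-comm _ (received initial (O z) t) ⟩
        received initial (O z) t + received e R t
          ≡⟨ cong (received initial (O z) t +_) (received-% e′≡e R t) ⟨
        received initial (O z) t + received e′ R t
          ≡⟨ received-mirror (mono z≤L+P) t ⟩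
        received initial (O (L + P)) t
          ∎
        where
        open ≡-Reasoning
        z : ℕ
        z = P ∸ y
        e e′ R : Fin n → ℕ
        e w = mirror w (O L w)
        e′ w = mirror w (O (L + P) w)
        R w = O (L + P) w ∸ O z w
        L+P≡ : L + P ≡ z + (L + y)
        L+P≡ = trans (cong (L +_) (trans (sym (m∸n+n≡m y≤P)) (+-comm z y)))
                     (trans (sym (+-assoc L y z)) (+-comm (L + y) z))
        z≤L+P : z ≤ L + P
        z≤L+P = subst (z ≤_) (sym L+P≡) (m≤m+n z (L + y))
        e′≡e : ∀ w → e′ w % d w ≡ e w % d w
        e′≡e w = mirror-% w (sym (OL≡OL+P w))
        odometer-R : Odometer e (L + y) R
        odometer-R = Odometer-% e′≡e (Odometer-mirror (odometer z)
          (subst (λ K → Odometer initial K (O (L + P))) L+P≡ (odometer (L + P))) (mono z≤L+P))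

module RotorWalk {n : ℕ} (d : Fin n → ℕ) (hd : (v : Fin n) → Fin (d v) → Fin n)
  (d≢0 : ∀ v → NonZero (d v)) (pal : PalindromicRotors d hd)
  {T : Subset n} {s : Fin n} (s∉T : s ∉ T) (T→s : ∀ v → v ∈ T → ∀ (i : Fin (d v)) → hd v i ≡ s)
  {x : ℕ → Fin n} (walk : IsRotorWalk d hd s x)
  {t : ℕ → Fin n} (hitting : IsHittingSequence T x t) where

  open Rotors d hd d≢0
  open ChipFiring T s s∉T

  visits : Fin n → ℕ → ℕ
  visits v = count x v

  occ≡visits : ∀ v k → occ d hd x v k ≡ visits v (suc k)
  occ≡visits v zero    = refl
  occ≡visits v (suc k) = cong (_+ δ (x (suc k)) v) (occ≡visits v k)

  x-suc≡rotor : ∀ k → x (suc k) ≡ rotor (x k) (visits (x k) k)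
  x-suc≡rotor k with proj₂ walk k
  ... | j , q , occ≡ , x-suc≡ = trans x-suc≡ (sym (trans (rotor-% (x k) visits≡%) (rotor-toℕ (x k) j)))
    where
    visits≡ : visits (x k) k ≡ toℕ j + q * d (x k)
    visits≡ = suc-injective (begin
      suc (visits (x k) k)             ≡⟨ +-comm 1 _ ⟩
      visits (x k) k + 1               ≡⟨ cong (visits (x k) k +_) (δ-refl (x k)) ⟨
      visits (x k) (suc k)             ≡⟨ occ≡visits (x k) k ⟨
      occ d hd x (x k) k               ≡⟨ occ≡ ⟩
      suc (toℕ j + q * d (x k))        ∎)
      where open ≡-Reasoning
    visits≡% : visits (x k) k % d (x k) ≡ toℕ j % d (x k)
    visits≡% = trans (cong (_% d (x k)) visits≡) ([m+kn]%n≡m%n (toℕ j) q (d (x k)))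

  visits-suc-arrivals : ∀ τ v → visits v (suc τ) ≡ δ s v + sum (λ w → sends w v 0 (visits w τ))
  visits-suc-arrivals zero    v = trans (cong (λ z → δ z v) (proj₁ walk))
    (sym (trans (cong (δ s v +_) (sum-replicate-zero n)) (+-identityʳ _)))
  visits-suc-arrivals (suc τ) v = begin
    visits v (suc τ) + δ (x (suc τ)) v
      ≡⟨ cong (_+ δ (x (suc τ)) v) (visits-suc-arrivals τ v) ⟩
    δ s v + A + δ (x (suc τ)) v
      ≡⟨ +-assoc (δ s v) A _ ⟩
    δ s v + (A + δ (x (suc τ)) v)
      ≡⟨ cong (λ z → δ s v + (A + z)) last-departure ⟨
    δ s v + (A + sum (λ w → sends w v (visits w τ) (δ (x τ) w)))
      ≡⟨ cong (δ s v +_) (∑-distrib-+ (λ w → sends w v 0 (visits w τ)) _) ⟨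
    δ s v + sum (λ w → sends w v 0 (visits w τ) + sends w v (visits w τ) (δ (x τ) w))
      ≡⟨ cong (δ s v +_) (sum-cong-≗ (λ w → sends-+ w v 0 (visits w τ) (δ (x τ) w))) ⟨
    δ s v + sum (λ w → sends w v 0 (visits w (suc τ)))
      ∎
    where
    open ≡-Reasoning
    A : ℕ
    A = sum (λ w → sends w v 0 (visits w τ))
    last-departure : sum (λ w → sends w v (visits w τ) (δ (x τ) w)) ≡ δ (x (suc τ)) v
    last-departure = begin
      sum (λ w → sends w v (visits w τ) (δ (x τ) w))  ≡⟨ sum-single _ (x τ) only-xτ ⟩
      sends (x τ) v (visits (x τ) τ) (δ (x τ) (x τ))  ≡⟨ cong (sends (x τ) v (visits (x τ) τ)) (δ-refl (x τ)) ⟩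
      δ (rotor (x τ) (visits (x τ) τ)) v + 0          ≡⟨ +-identityʳ _ ⟩
      δ (rotor (x τ) (visits (x τ) τ)) v              ≡⟨ cong (λ z → δ z v) (x-suc≡rotor τ) ⟨
      δ (x (suc τ)) v                                 ∎
      where
      only-xτ : ∀ w → w ≢ x τ → sends w v (visits w τ) (δ (x τ) w) ≡ 0
      only-xτ w w≢xτ = cong (sends w v (visits w τ)) (δ-≢ (w≢xτ ∘ sym))

  sends-sink : ∀ {w} → w ∈ T → ∀ v a y → sends w v a y ≡ δ s v * y
  sends-sink     w∈T v a zero    = sym (*-zeroʳ (δ s v))
  sends-sink {w} w∈T v a (suc y) = trans
    (cong₂ _+_ (cong (λ z → δ z v) (T→s w w∈T _)) (sends-sink w∈T v (suc a) y)) (sym (*-suc (δ s v) y))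

  χ*sends : ∀ w v y → χ w * sends w v 0 y ≡ δ s v * (χ w * y)
  χ*sends w v y with w ∈? T
  ... | yes w∈T =
    trans (+-identityʳ _) (trans (sends-sink w∈T v 0 y) (cong (δ s v *_) (sym (+-identityʳ y))))
  ... | no  _   = sym (*-zeroʳ (δ s v))

  hitsBefore : ℕ → ℕ
  hitsBefore = tally x χ

  -- Every arrival from T is a chip returned to s.
  arrivals-split : ∀ τ v →
    sum (λ w → sends w v 0 (visits w τ))
      ≡ received initial (λ w → visits w τ) v + source (hitsBefore τ) v
  arrivals-split τ v = trans (sym (sum-χᶜ+χ (λ w → sends w v 0 (visits w τ))))
    (cong (received initial (λ w → visits w τ) v +_) (begin
      sum (λ w → χ w * sends w v 0 (visits w τ))  ≡⟨ sum-cong-≗ (λ w → χ*sends w v (visits w τ)) ⟩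
      sum (λ w → δ s v * (χ w * visits w τ))      ≡⟨ *-distribˡ-sum (δ s v) (λ w → χ w * visits w τ) ⟨
      δ s v * sum (λ w → χ w * visits w τ)        ≡⟨ cong (δ s v *_) (sum-*-count x χ τ) ⟩
      δ s v * hitsBefore τ                        ∎))
    where open ≡-Reasoning

  visits-suc : ∀ τ v →
    visits v (suc τ) ≡ source (suc (hitsBefore τ)) v + received initial (λ w → visits w τ) v
  visits-suc τ v = begin
    visits v (suc τ)                               ≡⟨ visits-suc-arrivals τ v ⟩
    δ s v + sum (λ w → sends w v 0 (visits w τ))   ≡⟨ cong (δ s v +_) (arrivals-split τ v) ⟩
    δ s v + (R + source (hitsBefore τ) v)          ≡⟨ cong (δ s v +_) (+-comm R _) ⟩
    δ s v + (source (hitsBefore τ) v + R)          ≡⟨ +-assoc (δ s v) _ R ⟨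
    δ s v + δ s v * hitsBefore τ + R               ≡⟨ cong (_+ R) (*-suc (δ s v) (hitsBefore τ)) ⟨
    source (suc (hitsBefore τ)) v + R              ∎
    where
    open ≡-Reasoning
    R : ℕ
    R = received initial (λ w → visits w τ) v

  σ : ℕ → ℕ
  σ = proj₁ hitting

  σ-< : ∀ i → σ i < σ (suc i)
  σ-< = proj₁ (proj₂ hitting)

  xσ-∈ : ∀ i → x (σ i) ∈ T
  xσ-∈ = proj₁ (proj₂ (proj₂ hitting))

  t≡xσ : ∀ i → t i ≡ x (σ i)
  t≡xσ = proj₁ (proj₂ (proj₂ (proj₂ hitting)))

  t-∈ : ∀ i → t i ∈ T
  t-∈ i = subst (_∈ T) (sym (t≡xσ i)) (xσ-∈ i)

  σ-mono-≤ : ∀ {i j} → i ≤ j → σ i ≤ σ j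
  σ-mono-≤ {i} i≤j with m≤n⇒∃[o]m+o≡n i≤j
  ... | k , refl = go k
    where
    go : ∀ k → σ i ≤ σ (i + k)
    go zero    = ≤-reflexive (cong σ (sym (+-identityʳ i)))
    go (suc k) = ≤-trans (≤-trans (go k) (<⇒≤ (σ-< (i + k))))
                         (≤-reflexive (cong σ (sym (+-suc i k))))

  hit-before : ∀ {m j} → j < σ m → x j ∈ T → ∃ λ i → i < m × σ i ≡ j
  hit-before {m} {j} j<σm xj∈T with proj₂ (proj₂ (proj₂ (proj₂ hitting))) j xj∈T
  ... | i , σi≡j with i <? m
  ...   | yes i<m = i , i<m , σi≡j
  ...   | no  i≮m = ⊥-elim (<⇒≱ j<σm (subst (σ m ≤_) σi≡j (σ-mono-≤ (≮⇒≥ i≮m))))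

  tally-gap : ∀ g → (∀ u → u ∉ T → g u ≡ 0) → ∀ a k → (∀ j → j < k → x (a + j) ∉ T) →
              tally x g (a + k) ≡ tally x g a
  tally-gap g g≡0 a zero    gap = cong (tally x g) (+-identityʳ a)
  tally-gap g g≡0 a (suc k) gap = trans (cong (tally x g) (+-suc a k))
    (trans (cong₂ _+_ (tally-gap g g≡0 a k (λ j j<k → gap j (m≤n⇒m≤1+n j<k))) (g≡0 _ (gap k ≤-refl)))
      (+-identityʳ _))

  tally-σ : ∀ g → (∀ u → u ∉ T → g u ≡ 0) → ∀ m → tally x g (σ m) ≡ tally t g m
  tally-σ g g≡0 zero = tally-gap g g≡0 0 (σ 0) no-hit
    where
    no-hit : ∀ j → j < σ 0 → x j ∉ T
    no-hit j j<σ0 x∈T with hit-before j<σ0 x∈T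
    ... | _ , () , _
  tally-σ g g≡0 (suc m) = begin
    tally x g (σ (suc m))           ≡⟨ cong (tally x g) (m+[n∸m]≡n (σ-< m)) ⟨
    tally x g (suc (σ m) + gap)     ≡⟨ tally-gap g g≡0 (suc (σ m)) gap no-hit ⟩
    tally x g (σ m) + g (x (σ m))   ≡⟨ cong₂ _+_ (tally-σ g g≡0 m) (cong g (sym (t≡xσ m))) ⟩
    tally t g m + g (t m)           ∎
    where
    open ≡-Reasoning
    gap : ℕ
    gap = σ (suc m) ∸ suc (σ m)
    before-σ-suc : ∀ {j} → j < gap → suc (σ m) + j < σ (suc m)
    before-σ-suc {j} j<gap = subst (suc (σ m) + j <_) (m+[n∸m]≡n (σ-< m)) (+-monoʳ-< (suc (σ m)) j<gap)
    no-hit : ∀ j → j < gap → x (suc (σ m) + j) ∉ T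
    no-hit j j<gap x∈T with hit-before (before-σ-suc j<gap) x∈T
    ... | i , i<1+m , σi≡ = <⇒≱ (s≤s (m≤m+n (σ m) j)) (subst (_≤ σ m) σi≡ (σ-mono-≤ (s≤s⁻¹ i<1+m)))

  hitsBefore-σ : ∀ m → hitsBefore (σ m) ≡ m
  hitsBefore-σ m = trans (tally-σ χ (λ _ → χ-∉) m) (tally-t-χ m)
    where
    tally-t-χ : ∀ m → tally t χ m ≡ m
    tally-t-χ zero    = refl
    tally-t-χ (suc m) = trans (cong₂ _+_ (tally-t-χ m) (χ-∈ (t-∈ m))) (+-comm m 1)

  -- firings K w: departures from w before the K-th hit of T.
  firings : ℕ → Fin n → ℕ
  firings zero    w = 0
  firings (suc m) w = visits w (σ m)

  firings-mono-≤ : ∀ {K K′} → K ≤ K′ → ∀ w → firings K w ≤ firings K′ w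
  firings-mono-≤ {zero}          _         w = z≤n
  firings-mono-≤ {suc m} {suc m′} (s≤s m≤m′) w = tally-mono-≤ x (λ a → δ a w) (σ-mono-≤ m≤m′)

  visits-σ-suc : ∀ m v → visits v (suc (σ m)) ≡ source (suc m) v + received initial (firings (suc m)) v
  visits-σ-suc m v = trans (visits-suc (σ m) v)
    (cong (λ h → source (suc h) v + received initial (firings (suc m)) v) (hitsBefore-σ m))

  firings-odometer : ∀ K → Odometer initial K (firings K)
  firings-odometer zero    = Odometer-zero initial
  firings-odometer (suc m) v v∉T = begin
    visits v (σ m)                                           ≡⟨ +-identityʳ _ ⟨
    visits v (σ m) + 0                                       ≡⟨ cong (visits v (σ m) +_) δ≡0 ⟨
    visits v (suc (σ m))                                     ≡⟨ visits-σ-suc m v ⟩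
    source (suc m) v + received initial (firings (suc m)) v  ∎
    where
    open ≡-Reasoning
    δ≡0 : δ (x (σ m)) v ≡ 0
    δ≡0 = δ-≢ λ xσm≡v → v∉T (subst (_∈ T) xσm≡v (xσ-∈ m))

  received-firings : ∀ K {u} → u ∈ T → received initial (firings K) u ≡ count t u K
  received-firings zero {u} u∈T = received-zero initial u
  received-firings (suc m) {u} u∈T = begin
    received initial (firings (suc m)) u
      ≡⟨ cong (_+ received initial (firings (suc m)) u) source≡0 ⟨
    source (suc m) u + received initial (firings (suc m)) u
      ≡⟨ visits-σ-suc m u ⟨
    visits u (σ m) + δ (x (σ m)) u
      ≡⟨ cong₂ _+_ (tally-σ (λ a → δ a u) δ-∉ m) (cong (λ z → δ z u) (sym (t≡xσ m))) ⟩
    count t u (suc m)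
      ∎
    where
    open ≡-Reasoning
    source≡0 : source (suc m) u ≡ 0
    source≡0 = cong (_* suc m) (δ-≢ λ s≡u → s∉T (subst (_∈ T) (sym s≡u) u∈T))
    δ-∉ : ∀ a → a ∉ T → δ a u ≡ 0
    δ-∉ a a∉T = δ-≢ λ a≡u → a∉T (subst (_∈ T) (sym a≡u) u∈T)

  hitting-palindromic : ∀ {L P} → (∀ w → firings L w % d w ≡ firings (L + P) w % d w) →
                        (∀ i → t (L + i) ≡ t i) → ∀ {i} → i < P → t i ≡ t (P ∸ suc i)
  hitting-palindromic {L} {P} firings≡ shift {i} i<P = count-palindrome t i<P split
    where
    u : Fin n
    u = t i
    received≡count : ∀ K → received initial (firings K) u ≡ count t u K
    received≡count K = received-firings K (t-∈ i)
    split : ∀ y → y ≤ P → count t u y + count t u (P ∸ y) ≡ count t u P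
    split y y≤P = +-cancelˡ-≡ (count t u L) _ _ (begin
      count t u L + (count t u y + count t u (P ∸ y))
        ≡⟨ +-assoc (count t u L) _ _ ⟨
      count t u L + count t u y + count t u (P ∸ y)
        ≡⟨ cong₂ _+_ (cong₂ _+_ (received≡count L) (received≡count y)) (received≡count (P ∸ y)) ⟨
      received initial (firings L) u + received initial (firings y) u + received initial (firings (P ∸ y)) u
        ≡⟨ sink-received-split pal firings firings-odometer firings-mono-≤ {L} firings≡ y≤P u (t-∈ i) ⟩
      received initial (firings (L + P)) u
        ≡⟨ received≡count (L + P) ⟩
      count t u (L + P)
        ≡⟨ tally-shift t (λ a → δ a u) L shift P ⟩
      count t u L + count t u P
        ∎)
      where open ≡-Reasoning

  periodic-hitting-palindromic : ∀ {D} → (∀ m → t (m + D) ≡ t m) → ∀ {i} → i < D → t i ≡ t (D ∸ suc i)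
  periodic-hitting-palindromic {D} per {i} i<D with pigeonhole-% (λ j → firings (j * D))
  ... | a , b , a<b , firings≡ = begin
    t i                      ≡⟨ hitting-palindromic firings≡′ (periodic-multiple t D per a) i<P ⟩
    t (P ∸ suc i)            ≡⟨ cong t (trans (+-∸-comm (c * D) i<D) (+-comm _ (c * D))) ⟩
    t (c * D + (D ∸ suc i))  ≡⟨ periodic-multiple t D per c (D ∸ suc i) ⟩
    t (D ∸ suc i)            ∎
    where
    open ≡-Reasoning
    c P : ℕ
    c = b ∸ suc a
    P = suc c * D
    i<P : i < P
    i<P = <-≤-trans i<D (m≤m+n D (c * D))
    aD+P≡bD : a * D + P ≡ b * D
    aD+P≡bD = trans (sym (*-distribʳ-+ D a (suc c))) (cong (_* D) (trans (+-suc a c) (m+[n∸m]≡n a<b)))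
    firings≡′ : ∀ w → firings (a * D) w % d w ≡ firings (a * D + P) w % d w
    firings≡′ w = trans (firings≡ w) (cong (λ K → firings K w % d w) (sym aD+P≡bD))

out-degree-nonZero : ∀ {n} {d : Fin n → ℕ} {hd : (v : Fin n) → Fin (d v) → Fin n} {s x} →
  StronglyConnected d hd → IsRotorWalk d hd s x → ∀ v → NonZero (d v)
out-degree-nonZero {d = d} {s = s} strong (x₀≡s , walk) v with v ≟ s
... | yes refl = nonZeroIndex (subst (λ z → Fin (d z)) x₀≡s (proj₁ (walk 0)))
... | no  v≢s with strong v s
...   | here     = ⊥-elim (v≢s refl)
...   | step i _ = nonZeroIndex i

walk-constant : ∀ {n} {d : Fin n → ℕ} {hd : (v : Fin n) → Fin (d v) → Fin n} {T : Subset n} {s x} →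
  s ∈ T → (∀ v → v ∈ T → ∀ (i : Fin (d v)) → hd v i ≡ s) → IsRotorWalk d hd s x → ∀ k → x k ≡ s
walk-constant s∈T T→s (x₀≡s , walk) zero    = x₀≡s
walk-constant {T = T} s∈T T→s (x₀≡s , walk) (suc k) with walk k
... | j , _ , _ , x-suc≡ =
  trans x-suc≡ (T→s _ (subst (_∈ T) (sym (walk-constant s∈T T→s (x₀≡s , walk) k)) s∈T) j)

theorem3 : ∀ {n : ℕ} (d : Fin n → ℕ) (hd : (v : Fin n) → Fin (d v) → Fin n) →
    StronglyConnected d hd →
    (s : Fin n) (T : Subset n) → Nonempty T →
    (∀ v → v ∈ T → ∀ (i : Fin (d v)) → hd v i ≡ s) →
    PalindromicRotors d hd →
    (x : ℕ → Fin n) → IsRotorWalk d hd s x →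
    (t : ℕ → Fin n) → IsHittingSequence T x t →
    (D : ℕ) → 1 ≤ D → (∀ m → t (m + D) ≡ t m) →
    ∀ i → i < D → t i ≡ t (D ∸ suc i)
theorem3 d hd strong s T _ T→s pal x walk t hitting D _ periodic i i<D with s ∈? T
... | yes s∈T = trans (t≡s i) (sym (t≡s (D ∸ suc i)))
  where
  t≡s : ∀ j → t j ≡ s
  t≡s j = trans (proj₁ (proj₂ (proj₂ (proj₂ hitting))) j) (walk-constant s∈T T→s walk _)
... | no  s∉T = periodic-hitting-palindromic periodic i<D
  where open RotorWalk d hd (out-degree-nonZero strong walk) pal s∉T T→s walk hitting
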